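{- Let $\mathbf{D}$ be a D-core algebra and $x,y\in D$. Then: (1a) $x\sqcap\top=x\sqcap x$, (1b) $x\sqcup\bot=x\sqcup x$; (2a) $\neg x\sqcap\top=\neg x$, (2b) $\lrcorner x\sqcup\bot=\lrcorner x$; (3a) $(x\sqcap y)\sqcap\top=x\sqcap y$, (3b) $(x\sqcup y)\sqcup\bot=x\sqcup y$; (4a) $\neg x\sqcap\neg\bot=\neg x$, (4b) $\lrcorner x\sqcup\lrcorner\top=\lrcorner x$; (5a) $x\vee\bot=x\sqcap x$, (5b) $x\wedge\top=x\sqcup x$; (6a) $\neg x\vee\bot=\neg x$, (6b) $\lrcorner x\wedge\top=\lrcorner x$; (7a) $(x\sqcap y)\vee\bot=x\sqcap y$, (7b) $(x\sqcup y)\wedge\top=x\sqcup y$; (8a) $x\sqcap(y\vee\top)=x\sqcap(x\vee y)$, (8b) $x\sqcup(y\wedge\bot)=x\sqcup(x\wedge y)$; (9a) $\bot\sqcap\bot=\bot$, (9b) $\top\sqcup\top=\top$; (10a) $(\bot\sqcap\neg x)\sqcap x=\bot$, (10b) $(\top\sqcup\lrcorner x)\sqcup x=\top$; (11a) $(\bot\sqcap x)\sqcap\neg x=\bot$, (11b) $(\top\sqcup x)\sqcup\lrcorner x=\top$; (12a) $\bot\sqcap\lrcorner x=\bot$, (12b) $\top\sqcup\neg x=\top$; (13a) $\bot\sqcap\neg\lrcorner x=\bot$, (13b) $\top\sqcup\lrcorner\neg x=\top$.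
   Context: Write $x\vee y:=\neg(\neg x\sqcap\neg y)$ and $x\wedge y:=\lrcorner(\lrcorner x\sqcup\lrcorner y)$. A D-core algebra is an algebra $(D;\sqcap,\sqcup,\neg,\lrcorner,\top,\bot)$ of type $(2,2,1,1,0,0)$ satisfying, for all $x,y,z\in D$: $x\sqcap y=y\sqcap x$; $x\sqcup y=y\sqcup x$; $\neg(x\sqcap x)=\neg x$; $\lrcorner(x\sqcup x)=\lrcorner x$; $x\sqcap(x\sqcup y)=x\sqcap x$; $x\sqcup(x\sqcap y)=x\sqcup x$; $x\sqcap(y\vee z)=(x\sqcap y)\vee(x\sqcap z)$; $x\sqcup(y\wedge z)=(x\sqcup y)\wedge(x\sqcup z)$; $\neg\neg(x\sqcap y)=x\sqcap y$; $\lrcorner\lrcorner(x\sqcup y)=x\sqcup y$; $x\sqcap\neg x=\bot$; $x\sqcup\lrcorner x=\top$; $(x\sqcap x)\sqcup(x\sqcap x)=(x\sqcup x)\sqcap(x\sqcup x)$. -}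

module Defs where

open import Level using (Level; suc)
open import Relation.Binary.PropositionalEquality using (_≡_)

record DCoreAlgebra (c : Level) : Set (suc c) where
  infixr 7 _⊓_
  infixr 6 _⊔_
  field
    D   : Set c
    _⊓_ : D → D → D
    _⊔_ : D → D → D
    ¬_  : D → D
    ⌟_  : D → D
    ⊤   : D
    ⊥   : D

  _∨_ : D → D → D
  x ∨ y = ¬ ((¬ x) ⊓ (¬ y))

  _∧_ : D → D → D
  x ∧ y = ⌟ ((⌟ x) ⊔ (⌟ y))

  field
    ⊓-comm   : ∀ x y → x ⊓ y ≡ y ⊓ x
    ⊔-comm   : ∀ x y → x ⊔ y ≡ y ⊔ x
    ¬-idem   : ∀ x → ¬ (x ⊓ x) ≡ ¬ x
    ⌟-idem   : ∀ x → ⌟ (x ⊔ x) ≡ ⌟ x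
    ⊓-absorb : ∀ x y → x ⊓ (x ⊔ y) ≡ x ⊓ x
    ⊔-absorb : ∀ x y → x ⊔ (x ⊓ y) ≡ x ⊔ x
    ⊓-distrib-∨ : ∀ x y z → x ⊓ (y ∨ z) ≡ (x ⊓ y) ∨ (x ⊓ z)
    ⊔-distrib-∧ : ∀ x y z → x ⊔ (y ∧ z) ≡ (x ⊔ y) ∧ (x ⊔ z)
    ¬¬-⊓     : ∀ x y → ¬ (¬ (x ⊓ y)) ≡ x ⊓ y
    ⌟⌟-⊔     : ∀ x y → ⌟ (⌟ (x ⊔ y)) ≡ x ⊔ y
    ⊓-¬      : ∀ x → x ⊓ (¬ x) ≡ ⊥
    ⊔-⌟      : ∀ x → x ⊔ (⌟ x) ≡ ⊤
    ⊓⊔-mid   : ∀ x → (x ⊓ x) ⊔ (x ⊓ x) ≡ (x ⊔ x) ⊓ (x ⊔ x)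

{-# OPTIONS --safe #-}
module Submission where

open import Defs
open import Level using (Level)
open import Data.Product using (_×_; _,_)
open import Relation.Binary.PropositionalEquality using (_≡_; sym; trans; cong; cong₂; module ≡-Reasoning)

-- Swapping ⊓ with ⊔, ¬ with ⌟ and ⊤ with ⊥ permutes the D-core axioms, so
-- every (b) item is the (a) item of the dual algebra.  For the (a) items:
-- ¬¬x = x ⊓ x, hence negations and meets are ⊓-idempotent; absorption with
-- ⊤ = x ⊔ ⌟x gives x ⊓ ⊤ = x ⊓ x, so ⊥ = ⊤ ⊓ ¬⊤ = ¬⊤; and distributing
-- x ⊓ (¬x ∨ ⊥) shows that ⊥ is absorbing for ⊓.

module DCoreProperties {c : Level} (A : DCoreAlgebra c) where
  open DCoreAlgebra A
  open ≡-Reasoning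

  ¬¬x≡x⊓x : ∀ x → ¬ ¬ x ≡ x ⊓ x
  ¬¬x≡x⊓x x = trans (cong ¬_ (sym (¬-idem x))) (¬¬-⊓ x x)

  ¬¬¬x≡¬x : ∀ x → ¬ ¬ ¬ x ≡ ¬ x
  ¬¬¬x≡¬x x = trans (cong ¬_ (¬¬x≡x⊓x x)) (¬-idem x)

  ¬x⊓¬x≡¬x : ∀ x → ¬ x ⊓ ¬ x ≡ ¬ x
  ¬x⊓¬x≡¬x x = trans (sym (¬¬x≡x⊓x (¬ x))) (¬¬¬x≡¬x x)

  [x⊓y]⊓[x⊓y]≡x⊓y : ∀ x y → (x ⊓ y) ⊓ (x ⊓ y) ≡ x ⊓ y
  [x⊓y]⊓[x⊓y]≡x⊓y x y = begin
    (x ⊓ y) ⊓ (x ⊓ y)             ≡⟨ sym (¬¬x≡x⊓x (x ⊓ y)) ⟩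
    ¬ ¬ (x ⊓ y)                   ≡⟨ ¬¬-⊓ x y ⟩
    x ⊓ y                         ∎

  x⊓¬¬y≡x⊓y : ∀ x y → x ⊓ ¬ ¬ y ≡ x ⊓ y
  x⊓¬¬y≡x⊓y x y = begin
    x ⊓ ¬ ¬ y                     ≡⟨ cong (x ⊓_) (sym (¬-idem (¬ y))) ⟩
    x ⊓ (y ∨ y)                   ≡⟨ ⊓-distrib-∨ x y y ⟩
    (x ⊓ y) ∨ (x ⊓ y)             ≡⟨ ¬-idem (¬ (x ⊓ y)) ⟩
    ¬ ¬ (x ⊓ y)                   ≡⟨ ¬¬-⊓ x y ⟩
    x ⊓ y                         ∎

  ∨-comm : ∀ x y → x ∨ y ≡ y ∨ x
  ∨-comm x y = cong ¬_ (⊓-comm (¬ x) (¬ y))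

  x⊓⊤≡x⊓x : ∀ x → x ⊓ ⊤ ≡ x ⊓ x
  x⊓⊤≡x⊓x x = trans (cong (x ⊓_) (sym (⊔-⌟ x))) (⊓-absorb x (⌟ x))

  ¬x⊓⊤≡¬x : ∀ x → ¬ x ⊓ ⊤ ≡ ¬ x
  ¬x⊓⊤≡¬x x = trans (x⊓⊤≡x⊓x (¬ x)) (¬x⊓¬x≡¬x x)

  [x⊓y]⊓⊤≡x⊓y : ∀ x y → (x ⊓ y) ⊓ ⊤ ≡ x ⊓ y
  [x⊓y]⊓⊤≡x⊓y x y = trans (x⊓⊤≡x⊓x (x ⊓ y)) ([x⊓y]⊓[x⊓y]≡x⊓y x y)

  ⊥≡¬⊤ : ⊥ ≡ ¬ ⊤
  ⊥≡¬⊤ = begin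
    ⊥                             ≡⟨ sym (⊓-¬ ⊤) ⟩
    ⊤ ⊓ ¬ ⊤                       ≡⟨ ⊓-comm ⊤ (¬ ⊤) ⟩
    ¬ ⊤ ⊓ ⊤                       ≡⟨ ¬x⊓⊤≡¬x ⊤ ⟩
    ¬ ⊤                           ∎

  ¬x⊓¬⊥≡¬x : ∀ x → ¬ x ⊓ ¬ ⊥ ≡ ¬ x
  ¬x⊓¬⊥≡¬x x = begin
    ¬ x ⊓ ¬ ⊥                     ≡⟨ cong (λ t → ¬ x ⊓ ¬ t) ⊥≡¬⊤ ⟩
    ¬ x ⊓ ¬ ¬ ⊤                   ≡⟨ x⊓¬¬y≡x⊓y (¬ x) ⊤ ⟩
    ¬ x ⊓ ⊤                       ≡⟨ ¬x⊓⊤≡¬x x ⟩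
    ¬ x                           ∎

  x∨⊥≡x⊓x : ∀ x → x ∨ ⊥ ≡ x ⊓ x
  x∨⊥≡x⊓x x = trans (cong ¬_ (¬x⊓¬⊥≡¬x x)) (¬¬x≡x⊓x x)

  ¬x∨⊥≡¬x : ∀ x → (¬ x) ∨ ⊥ ≡ ¬ x
  ¬x∨⊥≡¬x x = trans (cong ¬_ (¬x⊓¬⊥≡¬x (¬ x))) (¬¬¬x≡¬x x)

  [x⊓y]∨⊥≡x⊓y : ∀ x y → (x ⊓ y) ∨ ⊥ ≡ x ⊓ y
  [x⊓y]∨⊥≡x⊓y x y = trans (x∨⊥≡x⊓x (x ⊓ y)) ([x⊓y]⊓[x⊓y]≡x⊓y x y)

  x⊓[y∨⊤]≡x⊓[x∨y] : ∀ x y → x ⊓ (y ∨ ⊤) ≡ x ⊓ (x ∨ y)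
  x⊓[y∨⊤]≡x⊓[x∨y] x y = begin
    x ⊓ (y ∨ ⊤)                   ≡⟨ ⊓-distrib-∨ x y ⊤ ⟩
    (x ⊓ y) ∨ (x ⊓ ⊤)             ≡⟨ ∨-comm (x ⊓ y) (x ⊓ ⊤) ⟩
    (x ⊓ ⊤) ∨ (x ⊓ y)             ≡⟨ cong (_∨ (x ⊓ y)) (x⊓⊤≡x⊓x x) ⟩
    (x ⊓ x) ∨ (x ⊓ y)             ≡⟨ sym (⊓-distrib-∨ x x y) ⟩
    x ⊓ (x ∨ y)                   ∎

  ⊥⊓⊥≡⊥ : ⊥ ⊓ ⊥ ≡ ⊥
  ⊥⊓⊥≡⊥ = begin
    ⊥ ⊓ ⊥                         ≡⟨ cong₂ _⊓_ ⊥≡¬⊤ ⊥≡¬⊤ ⟩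
    ¬ ⊤ ⊓ ¬ ⊤                     ≡⟨ ¬x⊓¬x≡¬x ⊤ ⟩
    ¬ ⊤                           ≡⟨ sym ⊥≡¬⊤ ⟩
    ⊥                             ∎

  ⊓-zeroʳ : ∀ x → x ⊓ ⊥ ≡ ⊥
  ⊓-zeroʳ x = begin
    x ⊓ ⊥                         ≡⟨ sym ([x⊓y]∨⊥≡x⊓y x ⊥) ⟩
    (x ⊓ ⊥) ∨ ⊥                   ≡⟨ cong ((x ⊓ ⊥) ∨_) (sym (⊓-¬ x)) ⟩
    (x ⊓ ⊥) ∨ (x ⊓ ¬ x)           ≡⟨ sym (⊓-distrib-∨ x ⊥ (¬ x)) ⟩
    x ⊓ (⊥ ∨ (¬ x))               ≡⟨ cong (x ⊓_) (∨-comm ⊥ (¬ x)) ⟩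
    x ⊓ ((¬ x) ∨ ⊥)               ≡⟨ cong (x ⊓_) (¬x∨⊥≡¬x x) ⟩
    x ⊓ ¬ x                       ≡⟨ ⊓-¬ x ⟩
    ⊥                             ∎

  ⊓-zeroˡ : ∀ x → ⊥ ⊓ x ≡ ⊥
  ⊓-zeroˡ x = trans (⊓-comm ⊥ x) (⊓-zeroʳ x)

  [⊥⊓x]⊓y≡⊥ : ∀ x y → (⊥ ⊓ x) ⊓ y ≡ ⊥
  [⊥⊓x]⊓y≡⊥ x y = trans (cong (_⊓ y) (⊓-zeroˡ x)) (⊓-zeroˡ y)

dual : ∀ {c} → DCoreAlgebra c → DCoreAlgebra c
dual A = record
  { D = D ; _⊓_ = _⊔_ ; _⊔_ = _⊓_ ; ¬_ = ⌟_ ; ⌟_ = ¬_ ; ⊤ = ⊥ ; ⊥ = ⊤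
  ; ⊓-comm = ⊔-comm ; ⊔-comm = ⊓-comm ; ¬-idem = ⌟-idem ; ⌟-idem = ¬-idem
  ; ⊓-absorb = ⊔-absorb ; ⊔-absorb = ⊓-absorb
  ; ⊓-distrib-∨ = ⊔-distrib-∧ ; ⊔-distrib-∧ = ⊓-distrib-∨
  ; ¬¬-⊓ = ⌟⌟-⊔ ; ⌟⌟-⊔ = ¬¬-⊓ ; ⊓-¬ = ⊔-⌟ ; ⊔-⌟ = ⊓-¬
  ; ⊓⊔-mid = λ x → sym (⊓⊔-mid x)
  }
  where open DCoreAlgebra A

proposition3p5 : ∀ {c : Level} (A : DCoreAlgebra c) → let open DCoreAlgebra A in ∀ (x y : D) →
      ((x ⊓ ⊤ ≡ x ⊓ x) × (x ⊔ ⊥ ≡ x ⊔ x))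
    × (((¬ x) ⊓ ⊤ ≡ ¬ x) × ((⌟ x) ⊔ ⊥ ≡ ⌟ x))
    × (((x ⊓ y) ⊓ ⊤ ≡ x ⊓ y) × ((x ⊔ y) ⊔ ⊥ ≡ x ⊔ y))
    × (((¬ x) ⊓ (¬ ⊥) ≡ ¬ x) × ((⌟ x) ⊔ (⌟ ⊤) ≡ ⌟ x))
    × ((x ∨ ⊥ ≡ x ⊓ x) × (x ∧ ⊤ ≡ x ⊔ x))
    × (((¬ x) ∨ ⊥ ≡ ¬ x) × ((⌟ x) ∧ ⊤ ≡ ⌟ x))
    × (((x ⊓ y) ∨ ⊥ ≡ x ⊓ y) × ((x ⊔ y) ∧ ⊤ ≡ x ⊔ y))
    × ((x ⊓ (y ∨ ⊤) ≡ x ⊓ (x ∨ y)) × (x ⊔ (y ∧ ⊥) ≡ x ⊔ (x ∧ y)))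
    × ((⊥ ⊓ ⊥ ≡ ⊥) × (⊤ ⊔ ⊤ ≡ ⊤))
    × (((⊥ ⊓ (¬ x)) ⊓ x ≡ ⊥) × ((⊤ ⊔ (⌟ x)) ⊔ x ≡ ⊤))
    × (((⊥ ⊓ x) ⊓ (¬ x) ≡ ⊥) × ((⊤ ⊔ x) ⊔ (⌟ x) ≡ ⊤))
    × ((⊥ ⊓ (⌟ x) ≡ ⊥) × (⊤ ⊔ (¬ x) ≡ ⊤))
    × ((⊥ ⊓ (¬ (⌟ x)) ≡ ⊥) × (⊤ ⊔ (⌟ (¬ x)) ≡ ⊤))
proposition3p5 A x y =
    (a.x⊓⊤≡x⊓x x , b.x⊓⊤≡x⊓x x)
  , (a.¬x⊓⊤≡¬x x , b.¬x⊓⊤≡¬x x)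
  , (a.[x⊓y]⊓⊤≡x⊓y x y , b.[x⊓y]⊓⊤≡x⊓y x y)
  , (a.¬x⊓¬⊥≡¬x x , b.¬x⊓¬⊥≡¬x x)
  , (a.x∨⊥≡x⊓x x , b.x∨⊥≡x⊓x x)
  , (a.¬x∨⊥≡¬x x , b.¬x∨⊥≡¬x x)
  , (a.[x⊓y]∨⊥≡x⊓y x y , b.[x⊓y]∨⊥≡x⊓y x y)
  , (a.x⊓[y∨⊤]≡x⊓[x∨y] x y , b.x⊓[y∨⊤]≡x⊓[x∨y] x y)
  , (a.⊥⊓⊥≡⊥ , b.⊥⊓⊥≡⊥)
  , (a.[⊥⊓x]⊓y≡⊥ _ x , b.[⊥⊓x]⊓y≡⊥ _ x)
  , (a.[⊥⊓x]⊓y≡⊥ x _ , b.[⊥⊓x]⊓y≡⊥ x _)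
  , (a.⊓-zeroˡ _ , b.⊓-zeroˡ _)
  , (a.⊓-zeroˡ _ , b.⊓-zeroˡ _)
  where
    module a = DCoreProperties A
    module b = DCoreProperties (dual A)
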